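{- Let $S\subset \mathbb{Z}^n$ be a realizable set. Then all realizations of $S$ are equivalent if and only if for every $x,y\in S$ with $\max_{i\in [n]}|x_i-y_i|=1$ there exists $i\in[n]$ such that either $x_i<y_i$ and $\{z\in D_S(y): z_i=y_i-1\}=\{x\}$, or $y_i<x_i$ and $\{z\in D_S(x): z_i=x_i-1\}=\{y\}$.
   Context: All graphs are finite, simple and connected. For a graph $G$ and an ordered vertex subset $W=\{\omega^1,\dots,\omega^n\}$, $r(u\mid W)=(d(u,\omega^1),\dots,d(u,\omega^n))$; $W$ is resolving if these vectors are pairwise distinct. A finite $S\subset\mathbb{Z}^n$ is realizable if there is a graph $G$ and resolving set $W$ with $S=\{r(u\mid W):u\in V(G)\}$; $(G,W)$ is a realization of $S$. Two realizations $(G,W)$ and $(G',W')$ of $S$ are equivalent if the map $f:V(G)\to V(G')$ with $r(u\mid W)=r(f(u)\mid W')$ is a graph isomorphism. For $x\in\mathbb{Z}^n$, $D_S(x)=\{y\in S: \max_{i\in[n]}|x_i-y_i|=1\}$. -}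

module Defs where

open import Level using (0ℓ)
open import Data.Nat as ℕ using (ℕ; zero; suc; _≤_; _⊔_)
open import Data.Integer as ℤ using (ℤ; +_; ∣_∣; _-_; _<_)
open import Data.Fin using (Fin)
open import Data.Vec using (Vec; lookup; zipWith; foldr)
open import Data.List using (List)
open import Data.List.Membership.Propositional using (_∈_)
open import Data.Product using (Σ; ∃; _×_; _,_)
open import Data.Sum using (_⊎_)
open import Relation.Nullary using (¬_)
open import Relation.Binary.PropositionalEquality using (_≡_)
open import Function.Bundles using (_⇔_)
open import Function.Definitions using (Injective; Bijective)

module _ {m : ℕ} (Adj : Fin m → Fin m → Set) where
  data Walk : Fin m → Fin m → ℕ → Set where
    nil  : ∀ u → Walk u u zero
    cons : ∀ {u w v k} → Adj u w → Walk w v k → Walk u v (suc k)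

record Graph : Set₁ where
  field
    order     : ℕ
    nonempty  : 1 ≤ order
    Adj       : Fin order → Fin order → Set
    symmetric : ∀ u v → Adj u v → Adj v u
    irreflex  : ∀ u → ¬ Adj u u
    connected : ∀ u v → ∃ λ k → Walk Adj u v k

  V : Set
  V = Fin order

  IsDist : V → V → ℕ → Set
  IsDist u v k = Walk Adj u v k × (∀ j → Walk Adj u v j → k ≤ j)

open Graph public

Rep : ∀ {n} (G : Graph) → (Fin n → V G) → V G → Vec ℤ n → Set
Rep G W u x = ∀ i → Σ ℕ λ k → lookup x i ≡ + k × IsDist G u (W i) k

Resolving : ∀ {n} (G : Graph) → (Fin n → V G) → Set
Resolving G W = ∀ u v x → Rep G W u x → Rep G W v x → u ≡ v

-- A realization (G , W) of S ⊂ ℤⁿ (S given as a finite list, read as a set);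
-- W = (ω¹,…,ωⁿ) is an ordered set of n distinct vertices.
record Realization {n : ℕ} (S : List (Vec ℤ n)) : Set₁ where
  field
    graph     : Graph
    landmarks : Fin n → V graph
    distinct  : Injective _≡_ _≡_ landmarks
    resolving : Resolving graph landmarks
    image⊆    : ∀ u → ∃ λ x → x ∈ S × Rep graph landmarks u x
    ⊆image    : ∀ x → x ∈ S → ∃ λ u → Rep graph landmarks u x
open Realization public

Realizable : ∀ {n} → List (Vec ℤ n) → Set₁
Realizable S = Realization S

Equivalent : ∀ {n} {S : List (Vec ℤ n)} → Realization S → Realization S → Set
Equivalent R R' =
  ∃ λ (f : V (graph R) → V (graph R')) →
    (∀ u x → Rep (graph R) (landmarks R) u x → Rep (graph R') (landmarks R') (f u) x)
    × Bijective _≡_ _≡_ f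
    × (∀ u v → (Adj (graph R) u v ⇔ Adj (graph R') (f u) (f v)))

AllRealizationsEquivalent : ∀ {n} → List (Vec ℤ n) → Set₁
AllRealizationsEquivalent S = (R R' : Realization S) → Equivalent R R'

cheb : ∀ {n} → Vec ℤ n → Vec ℤ n → ℕ
cheb x y = foldr _ _⊔_ 0 (zipWith (λ a b → ∣ a - b ∣) x y)

InD : ∀ {n} → List (Vec ℤ n) → Vec ℤ n → Vec ℤ n → Set
InD S x z = z ∈ S × cheb x z ≡ 1

UniqueLowerNbr : ∀ {n} → List (Vec ℤ n) → Fin n → Vec ℤ n → Vec ℤ n → Set
UniqueLowerNbr S i y x =
  ∀ z → (InD S y z × lookup z i ≡ lookup y i - + 1) ⇔ (z ≡ x)

Condition : ∀ {n} → List (Vec ℤ n) → Set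
Condition {n} S =
  ∀ x y → x ∈ S → y ∈ S → cheb x y ≡ 1 →
    ∃ λ (i : Fin n) →
      (lookup x i < lookup y i × UniqueLowerNbr S i y x)
      ⊎ (lookup y i < lookup x i × UniqueLowerNbr S i x y)

-- In any realization, adjacent vertices have representations at Chebyshev
-- distance 1, and a vertex at distance k + 1 from a landmark has a neighbour at
-- distance k from it. Conversely, every symmetric irreflexive relation on the
-- vertices with these two properties is the adjacency of a realization with the
-- same representations. If the condition holds, the unique lower neighbour it
-- provides is forced to be adjacent, so adjacency is exactly Chebyshev
-- distance 1 and is determined by S. If it fails for a pair x, y, the relation
-- "Chebyshev distance 1" keeps the descent property when the pair xy is
-- removed, and the two resulting realizations are not equivalent.
module Submission where

open import Defs
open import Data.Nat using (ℕ)
open import Data.Integer using (ℤ)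
open import Data.Vec using (Vec)
open import Data.List using (List)
open import Function.Bundles using (_⇔_)

open import Data.Nat as ℕ using (zero; suc; z≤n; s≤s; _⊔_)
import Data.Nat.Properties as ℕ
open import Data.Integer as ℤ using (+_; ∣_∣; _-_; _⊖_)
import Data.Integer.Properties as ℤ
open import Data.Fin using (Fin) renaming (zero to fzero; suc to fsuc)
open import Data.Fin.Properties using (_≟_; any?)
open import Data.Vec using (_∷_; []; lookup)
open import Data.Vec.Relation.Binary.Pointwise.Extensional using (ext; Pointwise-≡⇒≡)
open import Data.List.Membership.Propositional using (_∈_)
open import Data.Product using (∃; _×_; _,_; proj₁; proj₂)
import Data.Product as Product
open import Data.Sum using (_⊎_; inj₁; inj₂)
open import Data.Empty using (⊥-elim)
open import Relation.Nullary using (¬_; Dec; yes; no)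
open import Relation.Nullary.Decidable using (¬?; _×-dec_; _⊎-dec_; decidable-stable)
open import Relation.Binary.PropositionalEquality
open import Function.Bundles using (mk⇔; Equivalence)

module _ {m : ℕ} {A : Fin m → Fin m → Set} where

  Walk-++ : ∀ {u v w j k} → Walk A u v j → Walk A v w k → Walk A u w (j ℕ.+ k)
  Walk-++ (nil _)    q = q
  Walk-++ (cons a p) q = cons a (Walk-++ p q)

  Walk-snoc : ∀ {u v w k} → Walk A u v k → A v w → Walk A u w (suc k)
  Walk-snoc (nil _)    a = cons a (nil _)
  Walk-snoc (cons b p) a = cons b (Walk-snoc p a)

  Walk-reverse : (∀ u v → A u v → A v u) → ∀ {u v k} → Walk A u v k → Walk A v u k
  Walk-reverse A-sym (nil _)            = nil _
  Walk-reverse A-sym (cons {u} {w} a p) = Walk-snoc (Walk-reverse A-sym p) (A-sym u w a)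

module _ (G : Graph) where

  IsDist-unique : ∀ {u v k l} → IsDist G u v k → IsDist G u v l → k ≡ l
  IsDist-unique (p , p-min) (q , q-min) = ℕ.≤-antisym (p-min _ q) (q-min _ p)

  IsDist-refl : ∀ u → IsDist G u u 0
  IsDist-refl u = nil u , λ _ _ → z≤n

  IsDist-zero : ∀ {u v} → IsDist G u v 0 → u ≡ v
  IsDist-zero (nil _ , _) = refl

  IsDist-adj : ∀ {u v w k l} → Adj G u v → IsDist G u w k → IsDist G v w l → k ℕ.≤ suc l
  IsDist-adj uv (_ , u-min) (q , _) = u-min _ (cons uv q)

  IsDist-step : ∀ {u w k} → IsDist G u w (suc k) → ∃ λ v → Adj G u v × IsDist G v w k
  IsDist-step (cons {w = v} uv q , u-min) =
    v , uv , q , λ j r → ℕ.≤-pred (u-min (suc j) (cons uv r))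

  Rep-unique : ∀ {n} {W : Fin n → V G} {u x y} → Rep G W u x → Rep G W u y → x ≡ y
  Rep-unique {x = x} {y} rx ry = Pointwise-≡⇒≡ (ext same)
    where
    same : ∀ i → lookup x i ≡ lookup y i
    same i with rx i | ry i
    ... | k , xk , dk | l , yl , dl = trans xk (trans (cong +_ (IsDist-unique dk dl)) (sym yl))

∣+suc-+suc∣ : ∀ p q → ∣ + suc p - + suc q ∣ ≡ ∣ + p - + q ∣
∣+suc-+suc∣ p q = begin
  ∣ + suc p - + suc q ∣ ≡⟨ cong ∣_∣ (ℤ.m-n≡m⊖n (suc p) (suc q)) ⟩
  ∣ suc p ⊖ suc q ∣     ≡⟨ cong ∣_∣ (ℤ.[1+m]⊖[1+n]≡m⊖n p q) ⟩
  ∣ p ⊖ q ∣             ≡⟨ cong ∣_∣ (ℤ.m-n≡m⊖n p q) ⟨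
  ∣ + p - + q ∣         ∎
  where open ≡-Reasoning

∣+-+∣≤1⇒≤suc : ∀ p q → ∣ + p - + q ∣ ℕ.≤ 1 → p ℕ.≤ suc q
∣+-+∣≤1⇒≤suc zero    q       _ = z≤n
∣+-+∣≤1⇒≤suc (suc p) zero    h = subst (ℕ._≤ 1) (ℕ.+-identityʳ (suc p)) h
∣+-+∣≤1⇒≤suc (suc p) (suc q) h = s≤s (∣+-+∣≤1⇒≤suc p q (subst (ℕ._≤ 1) (∣+suc-+suc∣ p q) h))

≤suc⇒∣+-+∣≤1 : ∀ p q → p ℕ.≤ suc q → q ℕ.≤ suc p → ∣ + p - + q ∣ ℕ.≤ 1
≤suc⇒∣+-+∣≤1 zero    zero    _ _ = z≤n
≤suc⇒∣+-+∣≤1 zero    (suc q) _ h = h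
≤suc⇒∣+-+∣≤1 (suc p) zero    h _ = subst (ℕ._≤ 1) (sym (ℕ.+-identityʳ (suc p))) h
≤suc⇒∣+-+∣≤1 (suc p) (suc q) (s≤s h) (s≤s h′) =
  subst (ℕ._≤ 1) (sym (∣+suc-+suc∣ p q)) (≤suc⇒∣+-+∣≤1 p q h h′)

+suc-1 : ∀ k → + suc k - + 1 ≡ + k
+suc-1 k = trans (ℤ.[1+m]⊖[1+n]≡m⊖n k 0) (ℤ.⊖-≥ z≤n)

+≡+-1⇒suc≡ : ∀ m n → + m ≡ + n - + 1 → suc m ≡ n
+≡+-1⇒suc≡ m zero    ()
+≡+-1⇒suc≡ m (suc n) e = cong suc (ℤ.+-injective (trans e (+suc-1 n)))

∣x-y∣≤cheb : ∀ {n} (x y : Vec ℤ n) i → ∣ lookup x i - lookup y i ∣ ℕ.≤ cheb x y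
∣x-y∣≤cheb (a ∷ x) (b ∷ y) fzero    = ℕ.m≤m⊔n _ _
∣x-y∣≤cheb (a ∷ x) (b ∷ y) (fsuc i) = ℕ.≤-trans (∣x-y∣≤cheb x y i) (ℕ.m≤n⊔m _ _)

cheb-lub : ∀ {n} (x y : Vec ℤ n) {c} → (∀ i → ∣ lookup x i - lookup y i ∣ ℕ.≤ c) → cheb x y ℕ.≤ c
cheb-lub []      []      h = z≤n
cheb-lub (a ∷ x) (b ∷ y) h = ℕ.⊔-lub (h fzero) (cheb-lub x y (λ i → h (fsuc i)))

cheb≡0⇒≡ : ∀ {n} (x y : Vec ℤ n) → cheb x y ≡ 0 → x ≡ y
cheb≡0⇒≡ x y e = Pointwise-≡⇒≡ (ext same)
  where
  same : ∀ i → lookup x i ≡ lookup y i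
  same i = ℤ.i-j≡0⇒i≡j _ _ (ℤ.∣i∣≡0⇒i≡0 (ℕ.n≤0⇒n≡0
    (ℕ.≤-trans (∣x-y∣≤cheb x y i) (ℕ.≤-reflexive e))))

cheb-self : ∀ {n} (x : Vec ℤ n) → cheb x x ≡ 0
cheb-self x = ℕ.n≤0⇒n≡0 (cheb-lub x x λ i → ℕ.≤-reflexive (cong ∣_∣ (ℤ.+-inverseʳ (lookup x i))))

cheb-sym : ∀ {n} (x y : Vec ℤ n) → cheb x y ≡ cheb y x
cheb-sym []      []      = refl
cheb-sym (a ∷ x) (b ∷ y) = cong₂ _⊔_ (ℤ.∣i-j∣≡∣j-i∣ a b) (cheb-sym x y)

cheb≡1 : ∀ {n} (x y : Vec ℤ n) → (∀ i → ∣ lookup x i - lookup y i ∣ ℕ.≤ 1) → x ≢ y → cheb x y ≡ 1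
cheb≡1 x y h x≢y with cheb x y in e | cheb-lub x y h
... | zero        | _      = ⊥-elim (x≢y (cheb≡0⇒≡ x y e))
... | suc zero    | _      = refl
... | suc (suc _) | s≤s ()

cheb≡1⇒Fin : ∀ {n} (x y : Vec ℤ n) → cheb x y ≡ 1 → Fin n
cheb≡1⇒Fin []      []      ()
cheb≡1⇒Fin (a ∷ x) (b ∷ y) _ = fzero

module Realized {n : ℕ} {S : List (Vec ℤ n)} (R : Realization S) where

  G : Graph
  G = graph R

  W : Fin n → V G
  W = landmarks R

  ρ : V G → Vec ℤ n
  ρ u = proj₁ (image⊆ R u)

  ρ∈S : ∀ u → ρ u ∈ S
  ρ∈S u = proj₁ (proj₂ (image⊆ R u))

  ρ-Rep : ∀ u → Rep G W u (ρ u)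
  ρ-Rep u = proj₂ (proj₂ (image⊆ R u))

  d : V G → Fin n → ℕ
  d u i = proj₁ (ρ-Rep u i)

  ρ≡+d : ∀ u i → lookup (ρ u) i ≡ + d u i
  ρ≡+d u i = proj₁ (proj₂ (ρ-Rep u i))

  d-IsDist : ∀ u i → IsDist G u (W i) (d u i)
  d-IsDist u i = proj₂ (proj₂ (ρ-Rep u i))

  Rep⇒≡ρ : ∀ u x → Rep G W u x → x ≡ ρ u
  Rep⇒≡ρ u x r = Rep-unique G r (ρ-Rep u)

  ρ-injective : ∀ {u v} → ρ u ≡ ρ v → u ≡ v
  ρ-injective {u} {v} e = resolving R u v (ρ v) (subst (Rep G W u) e (ρ-Rep u)) (ρ-Rep v)

  ρ⁻¹ : ∀ x → x ∈ S → V G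
  ρ⁻¹ x x∈S = proj₁ (⊆image R x x∈S)

  ρ∘ρ⁻¹ : ∀ x (x∈S : x ∈ S) → ρ (ρ⁻¹ x x∈S) ≡ x
  ρ∘ρ⁻¹ x x∈S = sym (Rep⇒≡ρ _ x (proj₂ (⊆image R x x∈S)))

  d-landmark : ∀ i → d (W i) i ≡ 0
  d-landmark i = IsDist-unique G (d-IsDist (W i) i) (IsDist-refl G (W i))

  ∣ρ-ρ∣≡∣d-d∣ : ∀ u v i → ∣ lookup (ρ u) i - lookup (ρ v) i ∣ ≡ ∣ + d u i - + d v i ∣
  ∣ρ-ρ∣≡∣d-d∣ u v i = cong₂ (λ p q → ∣ p - q ∣) (ρ≡+d u i) (ρ≡+d v i)

  ρ<ρ⇒d<d : ∀ {u v i} → lookup (ρ u) i ℤ.< lookup (ρ v) i → d u i ℕ.< d v i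
  ρ<ρ⇒d<d {u} {v} {i} lt = ℤ.drop‿+<+ (subst₂ ℤ._<_ (ρ≡+d u i) (ρ≡+d v i) lt)

  d<d⇒ρ<ρ : ∀ {u v i} → d u i ℕ.< d v i → lookup (ρ u) i ℤ.< lookup (ρ v) i
  d<d⇒ρ<ρ {u} {v} {i} lt = subst₂ ℤ._<_ (sym (ρ≡+d u i)) (sym (ρ≡+d v i)) (ℤ.+<+ lt)

  d-pred⇒ρ-pred : ∀ {u v i} → suc (d u i) ≡ d v i → lookup (ρ u) i ≡ lookup (ρ v) i - + 1
  d-pred⇒ρ-pred {u} {v} {i} e = begin
    lookup (ρ u) i       ≡⟨ ρ≡+d u i ⟩
    + d u i              ≡⟨ +suc-1 (d u i) ⟨
    + suc (d u i) - + 1  ≡⟨ cong (λ k → + k - + 1) e ⟩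
    + d v i - + 1        ≡⟨ cong (_- + 1) (ρ≡+d v i) ⟨
    lookup (ρ v) i - + 1 ∎
    where open ≡-Reasoning

  ρ-pred⇒d-pred : ∀ {u v i} → lookup (ρ u) i ≡ lookup (ρ v) i - + 1 → suc (d u i) ≡ d v i
  ρ-pred⇒d-pred {u} {v} {i} e =
    +≡+-1⇒suc≡ _ _ (trans (sym (ρ≡+d u i)) (trans e (cong (_- + 1) (ρ≡+d v i))))

  d-descend : ∀ u i → 0 ℕ.< d u i → ∃ λ v → Adj G u v × suc (d v i) ≡ d u i
  d-descend u i = descend (d-IsDist u i)
    where
    descend : ∀ {k} → IsDist G u (W i) k → 0 ℕ.< k → ∃ λ v → Adj G u v × suc (d v i) ≡ k
    descend {suc k} dist _ with IsDist-step G dist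
    ... | v , uv , dist′ = v , uv , cong suc (IsDist-unique G (d-IsDist v i) dist′)

  Close : V G → V G → Set
  Close u v = cheb (ρ u) (ρ v) ≡ 1

  Close-sym : ∀ u v → Close u v → Close v u
  Close-sym u v = trans (cheb-sym (ρ v) (ρ u))

  Close-irrefl : ∀ u → ¬ Close u u
  Close-irrefl u c with () ← trans (sym (cheb-self (ρ u))) c

  Close⇒d≤suc : ∀ u v → Close u v → ∀ i → d u i ℕ.≤ suc (d v i)
  Close⇒d≤suc u v c i = ∣+-+∣≤1⇒≤suc _ _ (subst (ℕ._≤ 1) (∣ρ-ρ∣≡∣d-d∣ u v i)
    (ℕ.≤-trans (∣x-y∣≤cheb (ρ u) (ρ v) i) (ℕ.≤-reflexive c)))

  Adj⇒Close : ∀ {u v} → Adj G u v → Close u v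
  Adj⇒Close {u} {v} uv = cheb≡1 (ρ u) (ρ v) near
    (λ e → irreflex G v (subst (λ w → Adj G w v) (ρ-injective e) uv))
    where
    near : ∀ i → ∣ lookup (ρ u) i - lookup (ρ v) i ∣ ℕ.≤ 1
    near i = subst (ℕ._≤ 1) (sym (∣ρ-ρ∣≡∣d-d∣ u v i)) (≤suc⇒∣+-+∣≤1 _ _
      (IsDist-adj G uv (d-IsDist u i) (d-IsDist v i))
      (IsDist-adj G (symmetric G u v uv) (d-IsDist v i) (d-IsDist u i)))

  Close-descend : ∀ u i → 0 ℕ.< d u i → ∃ λ v → Close u v × suc (d v i) ≡ d u i
  Close-descend u i pos with d-descend u i pos
  ... | v , uv , dv = v , Adj⇒Close uv , dv

  UniqueLowerNbr⇒Adj : ∀ {u v i} → lookup (ρ u) i ℤ.< lookup (ρ v) i →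
    UniqueLowerNbr S i (ρ v) (ρ u) → Adj G v u
  UniqueLowerNbr⇒Adj {u} {v} {i} lt unique with d-descend v i (ℕ.≤-trans (s≤s z≤n) (ρ<ρ⇒d<d lt))
  ... | w , vw , dw = subst (Adj G v) (ρ-injective ρw≡ρu) vw
    where
    ρw≡ρu : ρ w ≡ ρ u
    ρw≡ρu = Equivalence.to (unique (ρ w)) ((ρ∈S w , Adj⇒Close vw) , d-pred⇒ρ-pred dw)

  Condition⇒Close⇒Adj : Condition S → ∀ {u v} → Close u v → Adj G u v
  Condition⇒Close⇒Adj cond {u} {v} c with cond (ρ u) (ρ v) (ρ∈S u) (ρ∈S v) c
  ... | i , inj₁ (lt , unique) = symmetric G v u (UniqueLowerNbr⇒Adj lt unique)
  ... | i , inj₂ (lt , unique) = UniqueLowerNbr⇒Adj lt unique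

  OtherLowerNbr : Fin n → V G → V G → Set
  OtherLowerNbr i s t = ∃ λ v → v ≢ t × Close s v × suc (d v i) ≡ d s i

  OtherLowerNbr? : ∀ i s t → Dec (OtherLowerNbr i s t)
  OtherLowerNbr? i s t = any? λ v →
    ¬? (v ≟ t) ×-dec (cheb (ρ s) (ρ v) ℕ.≟ 1) ×-dec (suc (d v i) ℕ.≟ d s i)

  Isolated : Fin n → V G → V G → Set
  Isolated i s t = d t i ℕ.< d s i × ¬ OtherLowerNbr i s t

  Isolated? : ∀ i s t → Dec (Isolated i s t)
  Isolated? i s t = (d t i ℕ.<? d s i) ×-dec ¬? (OtherLowerNbr? i s t)

  Isolated⇒UniqueLowerNbr : ∀ {i s t} → Close s t → Isolated i s t →
    lookup (ρ t) i ℤ.< lookup (ρ s) i × UniqueLowerNbr S i (ρ s) (ρ t)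
  Isolated⇒UniqueLowerNbr {i} {s} {t} st (lt , no-other) = d<d⇒ρ<ρ lt , λ z → mk⇔ (to z) from
    where
    to : ∀ z → InD S (ρ s) z × lookup z i ≡ lookup (ρ s) i - + 1 → z ≡ ρ t
    to z ((z∈S , sz) , zi) with ρ⁻¹ z z∈S | ρ∘ρ⁻¹ z z∈S
    ... | v | refl with v ≟ t
    ...   | yes v≡t = cong ρ v≡t
    ...   | no  v≢t = ⊥-elim (no-other (v , v≢t , sz , ρ-pred⇒d-pred zi))
    from : ∀ {z} → z ≡ ρ t → InD S (ρ s) z × lookup z i ≡ lookup (ρ s) i - + 1
    from refl = (ρ∈S t , st) , d-pred⇒ρ-pred (ℕ.≤-antisym lt (Close⇒d≤suc s t st i))

module _ {n : ℕ} {S : List (Vec ℤ n)} (R₁ R₂ : Realization S) where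
  private
    module R₁ = Realized R₁
    module R₂ = Realized R₂

  Equivalent⇒ρ-preserved : ((f , _) : Equivalent R₁ R₂) → ∀ u → R₂.ρ (f u) ≡ R₁.ρ u
  Equivalent⇒ρ-preserved (f , preserves , _) u =
    sym (R₂.Rep⇒≡ρ (f u) (R₁.ρ u) (preserves u (R₁.ρ u) (R₁.ρ-Rep u)))

  Condition⇒Equivalent : Condition S → Equivalent R₁ R₂
  Condition⇒Equivalent cond = f , preserves , (injective , surjective) , adjacent
    where
    f : V R₁.G → V R₂.G
    f u = R₂.ρ⁻¹ (R₁.ρ u) (R₁.ρ∈S u)
    ρ∘f : ∀ u → R₂.ρ (f u) ≡ R₁.ρ u
    ρ∘f u = R₂.ρ∘ρ⁻¹ (R₁.ρ u) (R₁.ρ∈S u)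
    g : V R₂.G → V R₁.G
    g v = R₁.ρ⁻¹ (R₂.ρ v) (R₂.ρ∈S v)

    preserves : ∀ u x → Rep R₁.G R₁.W u x → Rep R₂.G R₂.W (f u) x
    preserves u x r =
      subst (Rep R₂.G R₂.W (f u)) (trans (ρ∘f u) (sym (R₁.Rep⇒≡ρ u x r))) (R₂.ρ-Rep (f u))
    injective : ∀ {u v} → f u ≡ f v → u ≡ v
    injective {u} {v} e = R₁.ρ-injective (trans (sym (ρ∘f u)) (trans (cong R₂.ρ e) (ρ∘f v)))
    surjective : ∀ v → ∃ λ u → ∀ {w} → w ≡ u → f w ≡ v
    surjective v = g v , λ { refl →
      R₂.ρ-injective (trans (ρ∘f (g v)) (R₁.ρ∘ρ⁻¹ (R₂.ρ v) (R₂.ρ∈S v))) }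
    adjacent : ∀ u v → Adj R₁.G u v ⇔ Adj R₂.G (f u) (f v)
    adjacent u v = mk⇔
      (λ uv → R₂.Condition⇒Close⇒Adj cond
        (subst₂ (λ x y → cheb x y ≡ 1) (sym (ρ∘f u)) (sym (ρ∘f v)) (R₁.Adj⇒Close uv)))
      (λ uv → R₁.Condition⇒Close⇒Adj cond
        (subst₂ (λ x y → cheb x y ≡ 1) (ρ∘f u) (ρ∘f v) (R₂.Adj⇒Close uv)))

module Regraph {n : ℕ} {S : List (Vec ℤ n)} (R : Realization S) (i₀ : Fin n)
  (A : V (graph R) → V (graph R) → Set)
  (A-sym : ∀ u v → A u v → A v u)
  (A-irrefl : ∀ u → ¬ A u u)
  (A-d≤suc : ∀ u v → A u v → ∀ i → Realized.d R u i ℕ.≤ suc (Realized.d R v i))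
  (A-descend : ∀ u i → 0 ℕ.< Realized.d R u i →
                 ∃ λ v → A u v × suc (Realized.d R v i) ≡ Realized.d R u i)
  where
  open Realized R

  walk-to-landmark : ∀ u i {k} → d u i ≡ k → Walk A u (W i) k
  walk-to-landmark u i {zero} e = subst (λ w → Walk A w (W i) 0) (sym u≡Wi) (nil _)
    where
    u≡Wi : u ≡ W i
    u≡Wi = IsDist-zero G (subst (IsDist G u (W i)) e (d-IsDist u i))
  walk-to-landmark u i {suc k} e with A-descend u i (subst (0 ℕ.<_) (sym e) (s≤s z≤n))
  ... | v , uv , dv = cons uv (walk-to-landmark v i (ℕ.suc-injective (trans dv e)))

  d≤walk : ∀ i {u j} → Walk A u (W i) j → d u i ℕ.≤ j
  d≤walk i p = go p refl
    where
    go : ∀ {u t j} → Walk A u t j → t ≡ W i → d u i ℕ.≤ j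
    go (nil _)            refl = ℕ.≤-reflexive (d-landmark i)
    go (cons {u} {w} a p) e    = ℕ.≤-trans (A-d≤suc u w a i) (s≤s (go p e))

  G′ : Graph
  G′ = record
    { order     = order G
    ; nonempty  = nonempty G
    ; Adj       = A
    ; symmetric = A-sym
    ; irreflex  = A-irrefl
    ; connected = λ u v → _ , Walk-++ (walk-to-landmark u i₀ refl)
                                      (Walk-reverse A-sym (walk-to-landmark v i₀ refl))
    }

  ρ-Rep′ : ∀ u → Rep G′ W u (ρ u)
  ρ-Rep′ u i = d u i , ρ≡+d u i , walk-to-landmark u i refl , λ j → d≤walk i

  realization : Realization S
  realization = record
    { graph     = G′
    ; landmarks = W
    ; distinct  = distinct R
    ; resolving = λ u v x ru rv → ρ-injective
        (trans (sym (Rep-unique G′ {x = x} ru (ρ-Rep′ u))) (Rep-unique G′ {x = x} rv (ρ-Rep′ v)))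
    ; image⊆    = λ u → ρ u , ρ∈S u , ρ-Rep′ u
    ; ⊆image    = λ x x∈S →
        ρ⁻¹ x x∈S , subst (Rep G′ W (ρ⁻¹ x x∈S)) (ρ∘ρ⁻¹ x x∈S) (ρ-Rep′ (ρ⁻¹ x x∈S))
    }

PairCondition : ∀ {n} → List (Vec ℤ n) → Vec ℤ n → Vec ℤ n → Set
PairCondition {n} S x y = ∃ λ (i : Fin n) →
  (lookup x i ℤ.< lookup y i × UniqueLowerNbr S i y x)
  ⊎ (lookup y i ℤ.< lookup x i × UniqueLowerNbr S i x y)

module Necessity {n : ℕ} {S : List (Vec ℤ n)} (R : Realization S)
  {a b : V (graph R)} (ab : Realized.Close R a b) where
  open Realized R

  a≢b : a ≢ b
  a≢b refl = Close-irrefl a ab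

  Edge : V G → V G → Set
  Edge u v = (u ≡ a × v ≡ b) ⊎ (u ≡ b × v ≡ a)

  Edge? : ∀ u v → Dec (Edge u v)
  Edge? u v = (u ≟ a ×-dec v ≟ b) ⊎-dec (u ≟ b ×-dec v ≟ a)

  Edge-sym : ∀ {u v} → Edge u v → Edge v u
  Edge-sym (inj₁ e) = inj₂ (Product.swap e)
  Edge-sym (inj₂ e) = inj₁ (Product.swap e)

  Edge-functional : ∀ {u v w} → Edge u v → Edge u w → v ≡ w
  Edge-functional (inj₁ (_ , refl)) (inj₁ (_ , refl)) = refl
  Edge-functional (inj₁ (refl , _)) (inj₂ (a≡b , _))  = ⊥-elim (a≢b a≡b)
  Edge-functional (inj₂ (refl , _)) (inj₁ (b≡a , _))  = ⊥-elim (a≢b (sym b≡a))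
  Edge-functional (inj₂ (_ , refl)) (inj₂ (_ , refl)) = refl

  CloseWithoutEdge : V G → V G → Set
  CloseWithoutEdge u v = Close u v × ¬ Edge u v

  module Unisolated (unisolated : ∀ i → ¬ (Isolated i b a ⊎ Isolated i a b)) where

    Edge⇒OtherLowerNbr : ∀ {i s t} → Edge s t → d t i ℕ.< d s i → OtherLowerNbr i s t
    Edge⇒OtherLowerNbr {i} (inj₁ (refl , refl)) lt =
      decidable-stable (OtherLowerNbr? i _ _) λ ¬o → unisolated i (inj₂ (lt , ¬o))
    Edge⇒OtherLowerNbr {i} (inj₂ (refl , refl)) lt =
      decidable-stable (OtherLowerNbr? i _ _) λ ¬o → unisolated i (inj₁ (lt , ¬o))

    CloseWithoutEdge-descend : ∀ u i → 0 ℕ.< d u i →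
      ∃ λ v → CloseWithoutEdge u v × suc (d v i) ≡ d u i
    CloseWithoutEdge-descend u i pos with d-descend u i pos
    ... | v₀ , uv₀ , dv₀ with Edge? u v₀
    ...   | no ¬e = v₀ , (Adj⇒Close uv₀ , ¬e) , dv₀
    ...   | yes e with Edge⇒OtherLowerNbr e (ℕ.≤-reflexive dv₀)
    ...     | v , v≢v₀ , uv , dv = v , (uv , λ e′ → v≢v₀ (Edge-functional e′ e)) , dv

    i₀ : Fin n
    i₀ = cheb≡1⇒Fin (ρ a) (ρ b) ab

    module Complete = Regraph R i₀ Close Close-sym Close-irrefl Close⇒d≤suc Close-descend
    module Punctured = Regraph R i₀ CloseWithoutEdge
      (λ u v (uv , ¬e) → Close-sym u v uv , λ e → ¬e (Edge-sym e))
      (λ u (uu , _) → Close-irrefl u uu)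
      (λ u v (uv , _) → Close⇒d≤suc u v uv)
      CloseWithoutEdge-descend

    -- An equivalence of two regraphings fixes every vertex, so it cannot
    -- carry the edge ab of the first to the second.
    ¬all-equivalent : ¬ AllRealizationsEquivalent S
    ¬all-equivalent all = proj₂ ab′ (inj₁ (refl , refl))
      where
      equiv : Equivalent Complete.realization Punctured.realization
      equiv = all Complete.realization Punctured.realization
      fixed : ∀ u → proj₁ equiv u ≡ u
      fixed u = ρ-injective
        (Equivalent⇒ρ-preserved Complete.realization Punctured.realization equiv u)
      ab′ : CloseWithoutEdge a b
      ab′ = subst₂ CloseWithoutEdge (fixed a) (fixed b)
        (Equivalence.to (proj₂ (proj₂ (proj₂ equiv)) a b) ab)

  pairCondition : AllRealizationsEquivalent S → PairCondition S (ρ a) (ρ b)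
  pairCondition all with any? (λ i → Isolated? i b a ⊎-dec Isolated? i a b)
  ... | yes (i , inj₁ iso) = i , inj₁ (Isolated⇒UniqueLowerNbr (Close-sym a b ab) iso)
  ... | yes (i , inj₂ iso) = i , inj₂ (Isolated⇒UniqueLowerNbr ab iso)
  ... | no  ¬isolated = ⊥-elim (Unisolated.¬all-equivalent (λ i iso → ¬isolated (i , iso)) all)

theorem2p4 : (n : ℕ) (S : List (Vec ℤ n)) → Realizable S →
    (AllRealizationsEquivalent S ⇔ Condition S)
theorem2p4 n S R = mk⇔ necessity (λ cond R₁ R₂ → Condition⇒Equivalent R₁ R₂ cond)
  where
  open Realized R
  necessity : AllRealizationsEquivalent S → Condition S
  necessity all x y x∈S y∈S xy =
    subst₂ (PairCondition S) (ρ∘ρ⁻¹ x x∈S) (ρ∘ρ⁻¹ y y∈S) (Necessity.pairCondition R ab all)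
    where
    ab : Close (ρ⁻¹ x x∈S) (ρ⁻¹ y y∈S)
    ab = subst₂ (λ x′ y′ → cheb x′ y′ ≡ 1) (sym (ρ∘ρ⁻¹ x x∈S)) (sym (ρ∘ρ⁻¹ y y∈S)) xy
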